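{- Let $R$ be an integral domain, $\mathfrak G$ the matroid of a hyperplane arrangement on $[n]$, and $(\lambda,\eta)$ a resonant pair over $R$ with graph $\Gamma=\Gamma_{(\lambda,\eta)}$. Then (i) $\operatorname{supp}(\lambda,\eta)$ coincides with the set of non-cone vertices of $\Gamma$, and (ii) $\Gamma$ is transitive on $\operatorname{supp}(\lambda,\eta)$: whenever $i,j,k\in\operatorname{supp}(\lambda,\eta)$ with $\{i,j\},\{j,k\}$ edges of $\Gamma$ and $i\neq k$, $\{i,k\}$ is an edge of $\Gamma$.
   Context: Let $\mathcal A=\{H_1,\dots,H_n\}$ be an arrangement of distinct linear hyperplanes in $\mathbb C^\ell$ and $\mathfrak G$ its matroid on $[n]$: circuits are the minimal $C\subseteq[n]$ with $\operatorname{codim}\bigcap_{i\in C}H_i<|C|$. The Orlik–Solomon algebra $A_R(\mathfrak G)$ is the quotient of the exterior algebra over $R$ on $e_1,\dots,e_n$ by the ideal generated by $\partial e_C=\sum_{k=1}^p(-1)^{k-1}e_{i_1}\wedge\cdots\widehat{e_{i_k}}\cdots\wedge e_{i_p}$ for circuits $C=\{i_1<\dots<i_p\}$; $a_i$ is the image of $e_i$, $a_\xi=\sum_i\xi_ia_i$. $\lambda,\eta\in R^n$ are parallel if all $\lambda_i\eta_j-\lambda_j\eta_i=0$. A resonant pair is $(\lambda,\eta)$ with $a_\lambda\wedge a_\eta=0$ and $\eta$ not parallel to $\lambda$. $\operatorname{supp}(\lambda,\eta)=\{i:\lambda_i\ne0\text{ or }\eta_i\ne0\}$. $\Gamma_{(\lambda,\eta)}$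 is the graph on vertex set $[n]$ in which $\{i,j\}$ ($i\ne j$) is an edge iff $\lambda_i\eta_j-\lambda_j\eta_i=0$. A cone vertex is a vertex adjacent to every other vertex. -}

module Defs where

open import Level using (Level; _⊔_; suc)
open import Algebra.Bundles using (CommutativeRing)
open import Data.Bool using (Bool; true; false; if_then_else_)
import Data.Bool as Bool
open import Data.Nat using (ℕ; zero; suc)
open import Data.Fin using (Fin; zero; suc)
open import Data.Fin.Subset using (Subset; inside; outside; _∈_; _∉_; _⊆_; _∩_; _∪_; ⁅_⁆)
import Data.Fin.Subset as Sub
open import Data.List using (List; []; _∷_; map; foldr; _++_; allFin)
open import Data.List.Relation.Unary.All using (All)
open import Data.Vec using (Vec; []; _∷_)
import Data.Vec
import Relation.Nullary
open import Data.Vec.Properties using (≡-dec)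
open import Data.Product using (Σ; ∃; _×_; _,_; proj₁; proj₂)
open import Data.Sum using (_⊎_)
open import Relation.Nullary using (¬_; yes; no)
open import Relation.Binary.PropositionalEquality using (_≡_; _≢_)

record IsIntegralDomain {c ℓ} (R : CommutativeRing c ℓ) : Set (c ⊔ ℓ) where
  open CommutativeRing R
  field
    1≉0          : ¬ (1# ≈ 0#)
    noZeroDivisors : ∀ x y → (x * y) ≈ 0# → x ≈ 0# ⊎ y ≈ 0#

record Field (c ℓ : Level) : Set (Level.suc (c ⊔ ℓ)) where
  field
    commRing : CommutativeRing c ℓ
  open CommutativeRing commRing public
  field
    1≉0    : ¬ (1# ≈ 0#)
    invert : ∀ x → ¬ (x ≈ 0#) → Σ Carrier (λ y → (x * y) ≈ 1#)

subsets : (n : ℕ) → List (Subset n)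
subsets zero    = [] ∷ []
subsets (suc n) = map (inside ∷_) (subsets n) ++ map (outside ∷_) (subsets n)

_≟ˢ_ : ∀ {n} (S T : Subset n) → Relation.Nullary.Dec (S ≡ T)
_≟ˢ_ = ≡-dec Bool._≟_

-- number of inversions #{(s,t) : s ∈ S, t ∈ T, t < s}
inv : ∀ {n} → Subset n → Subset n → ℕ
inv []      []      = zero
inv (x ∷ S) (y ∷ T) = (if y then Sub.∣ S ∣ else zero) Data.Nat.+ inv S T

below : ∀ {n} → Fin n → Subset n → ℕ
below zero    _       = zero
below (suc i) (x ∷ C) = (if x then 1 else 0) Data.Nat.+ below i C

-- The hyperplane arrangement (given by defining linear forms α i over a
-- field K, H_i = ker α_i ⊆ K^ℓ) and its matroid.

module Arrangement {c ℓ} (K : Field c ℓ) {l n : ℕ} (α : Fin n → Fin l → Field.Carrier K) where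
  open Field K

  sumK : List Carrier → Carrier
  sumK = foldr _+_ 0#

  H : Fin n → (Fin l → Carrier) → Set ℓ
  H i v = sumK (map (λ t → α i t * v t) (allFin l)) ≈ 0#

  IsArrangementOfDistinctHyperplanes : Set (c ⊔ ℓ)
  IsArrangementOfDistinctHyperplanes =
    (∀ i → ¬ (∀ t → α i t ≈ 0#)) ×
    (∀ i j → i ≢ j → ¬ (∀ v → (H i v → H j v) × (H j v → H i v)))

  -- codim ⋂_{i∈C} H_i < |C|, i.e. the forms {α_i : i ∈ C} are linearly dependent
  Dependent : Subset n → Set (c ⊔ ℓ)
  Dependent C = Σ (Fin n → Carrier) λ k →
      (∀ i → i ∉ C → k i ≈ 0#)
    × (∃ λ i → i ∈ C × ¬ (k i ≈ 0#))
    × (∀ t → sumK (map (λ i → k i * α i t) (allFin n)) ≈ 0#)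

  IsCircuit : Subset n → Set (c ⊔ ℓ)
  IsCircuit C = Dependent C × (∀ D → D ⊆ C → D ≢ C → ¬ Dependent D)

-- Exterior algebra over R on e_1,…,e_n: elements are R-valued functions on
-- the basis {e_S : S ⊆ [n]} (e_S = e_{s_1}∧⋯∧e_{s_p}, s_1<⋯<s_p).

module Exterior {c ℓ} (R : CommutativeRing c ℓ) (n : ℕ) where
  open CommutativeRing R

  Ext : Set c
  Ext = Subset n → Carrier

  sumR : List Carrier → Carrier
  sumR = foldr _+_ 0#

  sgn : ℕ → Carrier
  sgn zero    = 1#
  sgn (suc k) = - sgn k

  _≈ᴱ_ : Ext → Ext → Set ℓ
  x ≈ᴱ y = ∀ U → x U ≈ y U

  zeroᴱ : Ext
  zeroᴱ _ = 0#

  _+ᴱ_ : Ext → Ext → Ext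
  (x +ᴱ y) U = x U + y U

  sumᴱ : List Ext → Ext
  sumᴱ = foldr _+ᴱ_ zeroᴱ

  -- coefficient of e_U in e_S ∧ e_T
  basisCoeff : Subset n → Subset n → Subset n → Carrier
  basisCoeff S T U with (S ∩ T) ≟ˢ Sub.⊥ | (S ∪ T) ≟ˢ U
  ... | yes _ | yes _ = sgn (inv S T)
  ... | _     | _     = 0#

  _∧_ : Ext → Ext → Ext
  (x ∧ y) U = sumR (map (λ S → sumR (map (λ T → basisCoeff S T U * (x S * y T)) (subsets n))) (subsets n))

  e : Fin n → Ext
  e i U with U ≟ˢ ⁅ i ⁆
  ... | yes _ = 1#
  ... | no  _ = 0#

  eᵥ : (Fin n → Carrier) → Ext
  eᵥ ξ = sumᴱ (map (λ i U → ξ i * e i U) (allFin n))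

  ∂ : Subset n → Ext
  ∂ C = sumᴱ (map (λ i U → if Data.Vec.lookup C i
                               then (if Relation.Nullary.does (U ≟ˢ (C Sub.- i)) then sgn (below i C) else 0#)
                               else 0#) (allFin n))

  InIdeal : ∀ {p} (P : Subset n → Set p) (g : Subset n → Ext) → Ext → Set (c ⊔ ℓ ⊔ p)
  InIdeal P g z = Σ (List (Ext × Subset n × Ext)) λ ts →
      All (λ t → P (proj₁ (proj₂ t))) ts
    × (z ≈ᴱ sumᴱ (map (λ t → (proj₁ t ∧ g (proj₁ (proj₂ t))) ∧ proj₂ (proj₂ t)) ts))

module Resonance {c ℓ c' ℓ'} (K : Field c' ℓ') {l n : ℕ} (α : Fin n → Fin l → Field.Carrier K)
                 (R : CommutativeRing c ℓ) where
  open CommutativeRing R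
  open Arrangement K α using (IsCircuit)
  open Exterior R n

  -- x = 0 in A_R(𝔊) for x in the exterior algebra: x lies in the OS ideal
  ZeroInOS : Ext → Set (c ⊔ ℓ ⊔ c' ⊔ ℓ')
  ZeroInOS = InIdeal IsCircuit ∂

  WedgeZero : (Fin n → Carrier) → (Fin n → Carrier) → Set (c ⊔ ℓ ⊔ c' ⊔ ℓ')
  WedgeZero λ' η = ZeroInOS (eᵥ λ' ∧ eᵥ η)

  Parallel : (Fin n → Carrier) → (Fin n → Carrier) → Set ℓ
  Parallel λ' η = ∀ i j → (λ' i * η j - λ' j * η i) ≈ 0#

  IsResonantPair : (Fin n → Carrier) → (Fin n → Carrier) → Set (c ⊔ ℓ ⊔ c' ⊔ ℓ')
  IsResonantPair λ' η = WedgeZero λ' η × ¬ Parallel λ' η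

  -- i ∈ supp(λ,η)  (λ_i ≠ 0 or η_i ≠ 0, read as ¬(λ_i = 0 ∧ η_i = 0))
  InSupp : (Fin n → Carrier) → (Fin n → Carrier) → Fin n → Set ℓ
  InSupp λ' η i = ¬ ((λ' i ≈ 0#) × (η i ≈ 0#))

  Edge : (Fin n → Carrier) → (Fin n → Carrier) → Fin n → Fin n → Set ℓ
  Edge λ' η i j = i ≢ j × (λ' i * η j - λ' j * η i) ≈ 0#

  IsConeVertex : (Fin n → Carrier) → (Fin n → Carrier) → Fin n → Set ℓ
  IsConeVertex λ' η i = ∀ j → j ≢ i → Edge λ' η i j

{-# OPTIONS --safe #-}
-- Over a domain a vertex j of the support is a pivot for the 2×2 minors
-- m(i,k) = λ_i η_k − λ_k η_i: if m(i,j) and m(j,k) vanish, then λ_j m(i,k) and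
-- η_j m(i,k) vanish, and as λ_j or η_j is nonzero, so does m(i,k).  This is (ii);
-- it also shows that a cone vertex in the support would make every minor vanish,
-- i.e. λ ∥ η.  A vertex outside the support has λ_i = η_i = 0, so every minor
-- through it vanishes and it is a cone vertex.
module Submission where

open import Defs
open import Algebra.Bundles using (CommutativeRing)
open import Data.Nat using (ℕ)
open import Data.Fin using (Fin; _≟_)
open import Data.Product using (_×_; _,_; proj₂)
open import Data.Sum using (inj₁; inj₂)
open import Data.Empty using (⊥-elim)
open import Relation.Nullary using (¬_; yes; no)
open import Relation.Binary.PropositionalEquality using (_≢_; refl; ≢-sym)

module CrossMultiplication {c ℓ} (R : CommutativeRing c ℓ) where
  open CommutativeRing R
  open import Algebra.Properties.CommutativeSemigroup *-commutativeSemigroup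
  open import Relation.Binary.Reasoning.Setoid setoid

  ae≈bd∧bf≈ce⇒b[af]≈b[cd] : ∀ {a b c d e f} → a * e ≈ b * d → b * f ≈ c * e →
                            b * (a * f) ≈ b * (c * d)
  ae≈bd∧bf≈ce⇒b[af]≈b[cd] {a} {b} {c} {d} {e} {f} ae≈bd bf≈ce = begin
    b * (a * f) ≈⟨ x∙yz≈y∙xz b a f ⟩
    a * (b * f) ≈⟨ *-congˡ bf≈ce ⟩
    a * (c * e) ≈⟨ x∙yz≈xz∙y a c e ⟩
    (a * e) * c ≈⟨ *-congʳ ae≈bd ⟩
    (b * d) * c ≈⟨ xy∙z≈x∙zy b d c ⟩
    b * (c * d) ∎

  ae≈bd∧bf≈ce⇒e[af]≈e[cd] : ∀ {a b c d e f} → a * e ≈ b * d → b * f ≈ c * e →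
                            e * (a * f) ≈ e * (c * d)
  ae≈bd∧bf≈ce⇒e[af]≈e[cd] {a} {b} {c} {d} {e} {f} ae≈bd bf≈ce = begin
    e * (a * f) ≈⟨ x∙yz≈yx∙z e a f ⟩
    (a * e) * f ≈⟨ *-congʳ ae≈bd ⟩
    (b * d) * f ≈⟨ xy∙z≈xz∙y b d f ⟩
    (b * f) * d ≈⟨ *-congʳ bf≈ce ⟩
    (c * e) * d ≈⟨ xy∙z≈y∙xz c e d ⟩
    e * (c * d) ∎

module IntegralDomainProperties {c ℓ} {R : CommutativeRing c ℓ} (dom : IsIntegralDomain R) where
  open CommutativeRing R
  open IsIntegralDomain dom
  open import Algebra.Properties.Ring ring using (x[y-z]≈xy-xz)
  open import Algebra.Properties.Group +-group using (x∙y⁻¹≈ε⇒x≈y; x≈y⇒x∙y⁻¹≈ε)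

  zx≈zy⇒z[x-y]≈0 : ∀ {x y z} → z * x ≈ z * y → z * (x - y) ≈ 0#
  zx≈zy⇒z[x-y]≈0 {x} {y} {z} zx≈zy = trans (x[y-z]≈xy-xz z x y) (x≈y⇒x∙y⁻¹≈ε zx≈zy)

  *-cancelˡ-jointly : ∀ {a b x y} → ¬ (a ≈ 0# × b ≈ 0#) →
                      a * x ≈ a * y → b * x ≈ b * y → x ≈ y
  *-cancelˡ-jointly {a} {b} {x} {y} a,b≉0 ax≈ay bx≈by
    with noZeroDivisors a (x - y) (zx≈zy⇒z[x-y]≈0 ax≈ay)
       | noZeroDivisors b (x - y) (zx≈zy⇒z[x-y]≈0 bx≈by)
  ... | inj₂ x-y≈0 | _          = x∙y⁻¹≈ε⇒x≈y x y x-y≈0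
  ... | _          | inj₂ x-y≈0 = x∙y⁻¹≈ε⇒x≈y x y x-y≈0
  ... | inj₁ a≈0   | inj₁ b≈0   = ⊥-elim (a,b≉0 (a≈0 , b≈0))

module Minors {c ℓ} {R : CommutativeRing c ℓ} (dom : IsIntegralDomain R) {n : ℕ}
              (λ' η : Fin n → CommutativeRing.Carrier R) where
  open CommutativeRing R
  open CrossMultiplication R
  open IntegralDomainProperties dom
  open import Algebra.Properties.Group +-group using (x∙y⁻¹≈ε⇒x≈y; x≈y⇒x∙y⁻¹≈ε)

  minor : Fin n → Fin n → Carrier
  minor i j = λ' i * η j - λ' j * η i

  Proportional : Fin n → Fin n → Set ℓ
  Proportional i j = λ' i * η j ≈ λ' j * η i

  Supported : Fin n → Set ℓ
  Supported i = ¬ (λ' i ≈ 0# × η i ≈ 0#)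

  minor≈0⇒proportional : ∀ {i j} → minor i j ≈ 0# → Proportional i j
  minor≈0⇒proportional = x∙y⁻¹≈ε⇒x≈y _ _

  proportional⇒minor≈0 : ∀ {i j} → Proportional i j → minor i j ≈ 0#
  proportional⇒minor≈0 = x≈y⇒x∙y⁻¹≈ε

  minor-refl : ∀ i → minor i i ≈ 0#
  minor-refl i = -‿inverseʳ (λ' i * η i)

  proportional-trans : ∀ {i j k} → Supported j →
                       Proportional i j → Proportional j k → Proportional i k
  proportional-trans j∈supp p q =
    *-cancelˡ-jointly j∈supp (ae≈bd∧bf≈ce⇒b[af]≈b[cd] p q) (ae≈bd∧bf≈ce⇒e[af]≈e[cd] p q)

  minor-trans : ∀ {i j k} → Supported j → minor i j ≈ 0# → minor j k ≈ 0# → minor i k ≈ 0#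
  minor-trans j∈supp m₁ m₂ = proportional⇒minor≈0
    (proportional-trans j∈supp (minor≈0⇒proportional m₁) (minor≈0⇒proportional m₂))

  unsupported⇒minor≈0 : ∀ {i} → λ' i ≈ 0# → η i ≈ 0# → ∀ j → minor i j ≈ 0#
  unsupported⇒minor≈0 {i} λᵢ≈0 ηᵢ≈0 j = proportional⇒minor≈0 (begin
    λ' i * η j ≈⟨ *-congʳ λᵢ≈0 ⟩
    0# * η j   ≈⟨ zeroˡ (η j) ⟩
    0#         ≈⟨ zeroʳ (λ' j) ⟨
    λ' j * 0#  ≈⟨ *-congˡ ηᵢ≈0 ⟨
    λ' j * η i ∎)
    where open import Relation.Binary.Reasoning.Setoid setoid

  supported-pivot⇒all-minors≈0 : ∀ {i} → Supported i → (∀ j → minor i j ≈ 0#) →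
                                 ∀ j k → minor j k ≈ 0#
  supported-pivot⇒all-minors≈0 i∈supp mᵢ≈0 j k = proportional⇒minor≈0
    (proportional-trans i∈supp (sym (minor≈0⇒proportional (mᵢ≈0 j)))
                               (minor≈0⇒proportional (mᵢ≈0 k)))

theorem3p9 : ∀ {c ℓ c' ℓ'} (K : Field c' ℓ') (R : CommutativeRing c ℓ) → IsIntegralDomain R →
    (l n : ℕ) (α : Fin n → Fin l → Field.Carrier K) →
    Arrangement.IsArrangementOfDistinctHyperplanes K α →
    (λ' η : Fin n → CommutativeRing.Carrier R) →
    Resonance.IsResonantPair K α R λ' η →
    (∀ i → (Resonance.InSupp K α R λ' η i → ¬ Resonance.IsConeVertex K α R λ' η i)
         × (¬ Resonance.IsConeVertex K α R λ' η i → Resonance.InSupp K α R λ' η i))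
    × (∀ i j k → Resonance.InSupp K α R λ' η i → Resonance.InSupp K α R λ' η j →
         Resonance.InSupp K α R λ' η k →
         Resonance.Edge K α R λ' η i j → Resonance.Edge K α R λ' η j k → i ≢ k →
         Resonance.Edge K α R λ' η i k)
theorem3p9 K R dom l n α _ λ' η (_ , not-parallel) =
  (λ _ → supported⇒not-cone , not-cone⇒supported)
  , λ _ _ _ _ j∈supp _ (_ , m₁) (_ , m₂) i≢k → i≢k , minor-trans j∈supp m₁ m₂
  where
  open CommutativeRing R using (_≈_; 0#)
  open Resonance K α R using (IsConeVertex)
  open Minors dom λ' η

  cone⇒minors≈0 : ∀ {i} → IsConeVertex λ' η i → ∀ j → minor i j ≈ 0#
  cone⇒minors≈0 {i} cone j with j ≟ i
  ... | yes refl = minor-refl i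
  ... | no j≢i   = proj₂ (cone j j≢i)

  supported⇒not-cone : ∀ {i} → Supported i → ¬ IsConeVertex λ' η i
  supported⇒not-cone i∈supp cone =
    not-parallel (supported-pivot⇒all-minors≈0 i∈supp (cone⇒minors≈0 cone))

  not-cone⇒supported : ∀ {i} → ¬ IsConeVertex λ' η i → Supported i
  not-cone⇒supported not-cone (λᵢ≈0 , ηᵢ≈0) =
    not-cone (λ j j≢i → ≢-sym j≢i , unsupported⇒minor≈0 λᵢ≈0 ηᵢ≈0 j)
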